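{- Let $\bar{\mathfrak{m}}=(H,\alpha,\bar\sigma)$ be a rooted unicellular map of genus $g+1$ with face $\bar\gamma=\alpha\bar\sigma$, and let $a_1,a_2,a_3$ be three distinct half-edges belonging to a same vertex $\bar v$, labelled so that $\bar v=(a_1,h_2^1,\dots,h_2^{m_2},a_2,h_3^1,\dots,h_3^{m_3},a_3,h_1^1,\dots,h_1^{m_1})$, and assume they are intertwined, i.e. they do not appear in the same cyclic order in $\bar\gamma$ as in $\bar\sigma$, so that $\bar\gamma=(a_1,k_2^1,\dots,k_2^{l_2},a_3,k_1^1,\dots,k_1^{l_1},a_2,k_3^1,\dots,k_3^{l_3})$. Let $\sigma$ be obtained from $\bar\sigma$ by replacing the cycle $\bar v$ by the product $(a_1,h_1^1,\dots,h_1^{m_1})(a_2,h_2^1,\dots,h_2^{m_2})(a_3,h_3^1,\dots,h_3^{m_3})$. Then $\mathfrak{m}=(H,\alpha,\sigma)$ (with the same root) is a well-defined unicellular map of genus $g$, whose face is $$\gamma=\alpha\sigma=(a_1,k_1^1,\dots,k_1^{l_1},a_2,k_2^1,\dots,k_2^{l_2},a_3,k_3^1,\dots,k_3^{l_3}).$$ Moreover this slicing operation and the gluing operation (which replaces three cycles $(a_1,h_1^1,\dots,h_1^{m_1}),(a_2,h_2^1,\dots,h_2^{m_2}),(a_3,h_3^1,\dots,h_3^{m_3})$ of three distinct vertices by the single cycle $(a_1,h_2^1,\dots,h_2^{m_2},a_2,h_3^1,\dots,h_3^{m_3},a_3,h_1^1,\dots,h_1^{m_1})$) are inverse to each other.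
   Context: A unicellular map with $n$ edges is a triple $\mathfrak{m}=(H,\alpha,\sigma)$ where $H$ is a set of $2n$ elements (half-edges), $\alpha$ is a fixed-point-free involution of $H$, and $\sigma$ is a permutation of $H$ such that $\gamma=\alpha\sigma$ (i.e. $\gamma(h)=\alpha(\sigma(h))$) consists of a single cycle; $\gamma$ is the face, the cycles of $\alpha$ are the edges and the cycles of $\sigma$ are the vertices. A rooted map carries a distinguished half-edge (the root). The genus $g$ is defined by $v=n+1-2g$, where $v$ is the number of vertices. -}

module Defs where

open import Data.Nat using (ℕ; zero; suc; _+_; _*_; _≤_; _<_; _≤?_)
open import Data.Fin using (Fin; toℕ; _≟_)
open import Data.Fin.Properties using (all?)
open import Data.List using (length; filter)
open import Data.List.Base using (allFin)
open import Data.Product using (∃; ∃-syntax; _×_; _,_)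
open import Relation.Binary.PropositionalEquality using (_≡_; _≢_)
open import Relation.Nullary using (¬_; yes; no; Dec)
open import Data.Fin.Permutation using (Permutation′; _⟨$⟩ʳ_)

iter : {A : Set} → (A → A) → ℕ → A → A
iter f zero x = x
iter f (suc k) x = f (iter f k x)

SameCycle : {N : ℕ} → (Fin N → Fin N) → Fin N → Fin N → Set
SameCycle p x y = ∃[ k ] iter p k x ≡ y

SingleCycle : {N : ℕ} → (Fin N → Fin N) → Set
SingleCycle p = ∀ x y → SameCycle p x y

-- Number of cycles of p : counted by choosing in each cycle its
-- element with the smallest index (every orbit of p on Fin N is
-- reached within N steps).
IsCycleMin : {N : ℕ} → (Fin N → Fin N) → Fin N → Set
IsCycleMin {N} p h = (k : Fin N) → toℕ h ≤ toℕ (iter p (toℕ k) h)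

isCycleMin? : {N : ℕ} → (p : Fin N → Fin N) → (h : Fin N) → Dec (IsCycleMin p h)
isCycleMin? p h = all? (λ k → toℕ h ≤? toℕ (iter p (toℕ k) h))

numCycles : {N : ℕ} → (Fin N → Fin N) → ℕ
numCycles {N} p = length (filter (isCycleMin? p) (allFin N))

CyclicOrder : {N : ℕ} → (Fin N → Fin N) → Fin N → Fin N → Fin N → Set
CyclicOrder p x y z =
  ∃[ i ] ∃[ j ] (0 < i × i < j × iter p i x ≡ y × iter p j x ≡ z
    × (∀ k → 0 < k → k ≤ j → iter p k x ≢ x))

-- A unicellular map with n edges on the half-edge set H = Fin (2 * n):
-- alpha a fixed-point-free involution, gamma = alpha ∘ sigma a single cycle.
record IsUnicellularMap (n : ℕ) (α σ : Permutation′ (2 * n)) : Set where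
  field
    involution   : ∀ h → α ⟨$⟩ʳ (α ⟨$⟩ʳ h) ≡ h
    fixpointFree : ∀ h → α ⟨$⟩ʳ h ≢ h
    oneFace      : SingleCycle (λ h → α ⟨$⟩ʳ (σ ⟨$⟩ʳ h))

HasGenus : (n : ℕ) → Permutation′ (2 * n) → ℕ → Set
HasGenus n σ g = numCycles (σ ⟨$⟩ʳ_) + 2 * g ≡ n + 1

-- Slicing at a1 a2 a3: the cycle (a1,h2..,a2,h3..,a3,h1..) is replaced by
-- (a1,h1..)(a2,h2..)(a3,h3..), i.e. a1 ↦ h1^1 = s a3, a2 ↦ h2^1 = s a1,
-- a3 ↦ h3^1 = s a2, every other half-edge keeps its image.
slice : {N : ℕ} → (Fin N → Fin N) → Fin N → Fin N → Fin N → Fin N → Fin N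
slice s a₁ a₂ a₃ h with h ≟ a₁
... | yes _ = s a₃
... | no _ with h ≟ a₂
...   | yes _ = s a₁
...   | no _ with h ≟ a₃
...     | yes _ = s a₂
...     | no _ = s h

-- Gluing at a1 a2 a3: the cycles (a1,h1..),(a2,h2..),(a3,h3..) are replaced
-- by (a1,h2..,a2,h3..,a3,h1..), i.e. a1 ↦ h2^1 = s a2, a2 ↦ h3^1 = s a3,
-- a3 ↦ h1^1 = s a1, every other half-edge keeps its image.
glue : {N : ℕ} → (Fin N → Fin N) → Fin N → Fin N → Fin N → Fin N → Fin N
glue s a₁ a₂ a₃ h with h ≟ a₁
... | yes _ = s a₂
... | no _ with h ≟ a₂
...   | yes _ = s a₃
...   | no _ with h ≟ a₃
...     | yes _ = s a₁
...     | no _ = s h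

-- Write τ = slice id a₁ a₂ a₃ for the 3-cycle rerouting a₁, a₂, a₃.  The sliced
-- vertex permutation is σ = σ̄ ∘ τ, so the new face α σ = (α σ̄) ∘ τ is the old
-- face γ̄ = α σ̄ sliced at the same three half-edges.  Everything then follows
-- from two facts about slicing a permutation π at points x, y, z of a cycle:
--   cut-cycle    if the cycle meets them in the order x, y, z, it is cut into
--                three cycles, through x, y and z respectively, so π gains two
--                cycles;
--   rotate-cycle if π is a single cycle meeting them in the order x, z, y, the
--                result is still a single cycle, now meeting them as x, y, z.
-- Applied to σ̄ the first gives three distinct new vertices and hence genus g;
-- applied to γ̄ (the intertwining hypothesis) the second shows the new map is
-- unicellular with face ordered a₁, a₂, a₃.

module Submission where

open import Defs
open import Data.Nat using (ℕ; zero; suc; _+_; _*_; _∸_; _≤_; _<_; z≤n; s≤s; s≤s⁻¹; _%_; _/_; _≤?_; >-nonZero)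
open import Data.Nat.Properties hiding (_≟_)
open import Data.Nat.DivMod using (m≡m%n+[m/n]*n; m%n<n)
open import Data.Fin using (Fin; toℕ; fromℕ<; _≟_)
import Data.Fin.Properties as Finₚ
open import Data.Fin.Permutation using (Permutation′; _⟨$⟩ʳ_; _⟨$⟩ˡ_; _∘ₚ_; permutation; inverseˡ; inverseʳ)
open import Data.List using (length; filter; tabulate)
open import Data.Product using (∃; ∃-syntax; _×_; _,_; proj₁; proj₂)
open import Data.Sum using (_⊎_; inj₁; inj₂)
open import Data.Empty using (⊥-elim)
open import Function using (_∘_; id)
open import Relation.Binary.Definitions using (tri<; tri≈; tri>)
open import Relation.Binary.PropositionalEquality using (_≡_; _≢_; refl; sym; trans; cong; cong₂; subst; subst₂; module ≡-Reasoning)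
open import Relation.Nullary using (¬_; Dec; yes; no)
open import Algebra.Properties.CommutativeMonoid.Sum +-0-commutativeMonoid using (sum; sum-cong-≗; sum-replicate-zero; ∑-distrib-+)

iter-add : ∀ {A : Set} (f : A → A) a b x → iter f (a + b) x ≡ iter f a (iter f b x)
iter-add f zero    b x = refl
iter-add f (suc a) b x = cong f (iter-add f a b x)

iter-periodic : ∀ {A : Set} (f : A → A) D x → iter f D x ≡ x → ∀ m → iter f (m * D) x ≡ x
iter-periodic f D x e zero    = refl
iter-periodic f D x e (suc m) = begin
  iter f (D + m * D) x        ≡⟨ iter-add f D (m * D) x ⟩
  iter f D (iter f (m * D) x) ≡⟨ cong (iter f D) (iter-periodic f D x e m) ⟩
  iter f D x                  ≡⟨ e ⟩
  x                           ∎
  where open ≡-Reasoning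

iter-mod : ∀ {A : Set} (f : A → A) D x → iter f (suc D) x ≡ x → ∀ k → iter f k x ≡ iter f (k % suc D) x
iter-mod f D x e k = begin
  iter f k x
    ≡⟨ cong (λ m → iter f m x) (m≡m%n+[m/n]*n k (suc D)) ⟩
  iter f (k % suc D + (k / suc D) * suc D) x
    ≡⟨ iter-add f (k % suc D) ((k / suc D) * suc D) x ⟩
  iter f (k % suc D) (iter f ((k / suc D) * suc D) x)
    ≡⟨ cong (iter f (k % suc D)) (iter-periodic f (suc D) x e (k / suc D)) ⟩
  iter f (k % suc D) x ∎
  where open ≡-Reasoning

above : ∀ a k → a < k → ∃[ t ] suc (a + t) ≡ k
above a k a<k = k ∸ suc a , m+[n∸m]≡n a<k

module Orbits {N : ℕ} (π : Permutation′ N) where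

  p : Fin N → Fin N
  p = π ⟨$⟩ʳ_

  iter-injective : ∀ k {a b} → iter p k a ≡ iter p k b → a ≡ b
  iter-injective zero    e = e
  iter-injective (suc k) e =
    iter-injective k (trans (sym (inverseˡ π)) (trans (cong (π ⟨$⟩ˡ_) e) (inverseˡ π)))

  -- By the pigeonhole principle every point returns to itself within N steps.
  period : ∀ h → ∃[ c ] (suc c ≤ N × iter p (suc c) h ≡ h)
  period h with Finₚ.pigeonhole (n<1+n N) (λ k → iter p (toℕ k) h)
  ... | i , j , i<j , e = c ∸ 1 , c≤N , returns
    where
    c : ℕ
    c = toℕ j ∸ toℕ i
    c-pos : suc (c ∸ 1) ≡ c
    c-pos = suc-pred c {{>-nonZero (m<n⇒0<n∸m i<j)}}
    c≤N : suc (c ∸ 1) ≤ N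
    c≤N = subst (_≤ N) (sym c-pos) (≤-trans (m∸n≤m (toℕ j) (toℕ i)) (Finₚ.toℕ≤pred[n] j))
    returns : iter p (suc (c ∸ 1)) h ≡ h
    returns = subst (λ m → iter p m h ≡ h) (sym c-pos) (iter-injective (toℕ i) (begin
      iter p (toℕ i) (iter p c h) ≡⟨ sym (iter-add p (toℕ i) c h) ⟩
      iter p (toℕ i + c) h        ≡⟨ cong (λ m → iter p m h) (m+[n∸m]≡n (<⇒≤ i<j)) ⟩
      iter p (toℕ j) h            ≡⟨ sym e ⟩
      iter p (toℕ i) h            ∎))
      where open ≡-Reasoning

  reduce : ∀ k h → ∃[ k′ ] (k′ < N × iter p k h ≡ iter p k′ h)
  reduce k h with period h
  ... | c , c<N , e = k % suc c , <-≤-trans (m%n<n k (suc c)) c<N , iter-mod p c h e k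

  same-trans : ∀ {a b c} → SameCycle p a b → SameCycle p b c → SameCycle p a c
  same-trans {a} (k₁ , e₁) (k₂ , e₂) = k₂ + k₁ , trans (iter-add p k₂ k₁ a) (trans (cong (iter p k₂) e₁) e₂)

  same-sym : ∀ {a b} → SameCycle p a b → SameCycle p b a
  same-sym {a} {b} (k , e) with period a
  ... | c , _ , returns = suc c ∸ r , (begin
      iter p (suc c ∸ r) b            ≡⟨ cong (iter p (suc c ∸ r)) (trans (sym e) (iter-mod p c a returns k)) ⟩
      iter p (suc c ∸ r) (iter p r a) ≡⟨ sym (iter-add p (suc c ∸ r) r a) ⟩
      iter p (suc c ∸ r + r) a        ≡⟨ cong (λ m → iter p m a) (m∸n+n≡m (<⇒≤ (m%n<n k (suc c)))) ⟩
      iter p (suc c) a                ≡⟨ returns ⟩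
      a                               ∎)
    where
    open ≡-Reasoning
    r : ℕ
    r = k % suc c

  same? : ∀ a b → Dec (SameCycle p a b)
  same? a b with Finₚ.any? (λ (k : Fin N) → iter p (toℕ k) a ≟ b)
  ... | yes (k , e) = yes (toℕ k , e)
  ... | no none = no λ (k , e) → none (bounded k e)
    where
    bounded : ∀ k → iter p k a ≡ b → ∃ λ (k : Fin N) → iter p (toℕ k) a ≡ b
    bounded k e with reduce k a
    ... | k′ , k′<N , e′ = fromℕ< k′<N , trans (cong (λ m → iter p m a) (Finₚ.toℕ-fromℕ< k′<N)) (trans (sym e′) e)

  cycleMin-below : ∀ h → IsCycleMin p h → ∀ k → toℕ h ≤ toℕ (iter p k h)
  cycleMin-below h min k with reduce k h
  ... | k′ , k′<N , e = subst (λ w → toℕ h ≤ toℕ w) (sym e)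
     (subst (λ m → toℕ h ≤ toℕ (iter p m h)) (Finₚ.toℕ-fromℕ< k′<N) (min (fromℕ< k′<N)))

  -- Every cycle has a minimum: descend along strictly smaller iterates.
  cycleMin : ∀ h → ∃[ m ] (SameCycle p h m × IsCycleMin p m)
  cycleMin h = descend (suc (toℕ h)) h ≤-refl
    where
    descend : ∀ (bound : ℕ) h → toℕ h < bound → ∃[ m ] (SameCycle p h m × IsCycleMin p m)
    descend (suc b) h h<b with isCycleMin? p h
    ... | yes min = h , (0 , refl) , min
    ... | no ¬min with Finₚ.¬∀⟶∃¬ N _ (λ k → toℕ h ≤? toℕ (iter p (toℕ k) h)) ¬min
    ... | k , smaller with descend b (iter p (toℕ k) h) (≤-trans (≰⇒> smaller) (s≤s⁻¹ h<b))
    ... | m , hm , min = m , same-trans (toℕ k , refl) hm , min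

  cycleMin-unique : ∀ {m m′} → IsCycleMin p m → IsCycleMin p m′ → SameCycle p m m′ → m ≡ m′
  cycleMin-unique {m} {m′} min min′ s@(k , e) with same-sym s
  ... | k′ , e′ = Finₚ.toℕ-injective (≤-antisym
        (subst (λ w → toℕ m ≤ toℕ w) e (cycleMin-below m min k))
        (subst (λ w → toℕ m′ ≤ toℕ w) e′ (cycleMin-below m′ min′ k′)))

  MinimalPeriod : Fin N → ℕ → Set
  MinimalPeriod x d = 0 < d × iter p d x ≡ x × (∀ m → 0 < m → m < d → iter p m x ≢ x)

  minimalPeriod : ∀ x → ∃[ d ] MinimalPeriod x d
  minimalPeriod x with period x
  ... | c , _ , e = shrink (suc c) c ≤-refl e
    where
    -- look for a shorter return time; there are fewer candidates each time
    shrink : ∀ (fuel : ℕ) D → D < fuel → iter p (suc D) x ≡ x → ∃[ d ] MinimalPeriod x d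
    shrink (suc fuel) D D<fuel e with Finₚ.any? (λ (m : Fin D) → iter p (suc (toℕ m)) x ≟ x)
    ... | yes (m , e′) = shrink fuel (toℕ m) (≤-trans (Finₚ.toℕ<n m) (s≤s⁻¹ D<fuel)) e′
    ... | no none = suc D , s≤s z≤n , e , noEarlierReturn
      where
      noEarlierReturn : ∀ m → 0 < m → m < suc D → iter p m x ≢ x
      noEarlierReturn (suc m) _ m<D e′ = none (fromℕ< (s≤s⁻¹ m<D) ,
        subst (λ k → iter p (suc k) x ≡ x) (sym (Finₚ.toℕ-fromℕ< (s≤s⁻¹ m<D))) e′)

  position : ∀ {x d w} → MinimalPeriod x d → SameCycle p x w → ∃[ k ] (k < d × iter p k x ≡ w)
  position {x} {suc d} (_ , returns , _) (k , e) =
    k % suc d , m%n<n k (suc d) , trans (sym (iter-mod p d x returns k)) e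

  position-unique : ∀ {x d} → MinimalPeriod x d → ∀ {e c} → e < d → c < d → iter p e x ≡ iter p c x → e ≡ c
  position-unique {x} {d} (_ , _ , noReturn) {e} {c} e<d c<d eq with <-cmp e c
  ... | tri≈ _ e≡c _ = e≡c
  ... | tri< e<c _ _ = ⊥-elim (noReturn (c ∸ e) (m<n⇒0<n∸m e<c) (≤-<-trans (m∸n≤m c e) c<d)
        (iter-injective e (trans (sym (iter-add p e (c ∸ e) x)) (trans (cong (λ m → iter p m x) (m+[n∸m]≡n (<⇒≤ e<c))) (sym eq)))))
  ... | tri> _ _ c<e = ⊥-elim (noReturn (e ∸ c) (m<n⇒0<n∸m c<e) (≤-<-trans (m∸n≤m e c) e<d)
        (iter-injective c (trans (sym (iter-add p c (e ∸ c) x)) (trans (cong (λ m → iter p m x) (m+[n∸m]≡n (<⇒≤ c<e))) eq))))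

-- Counting.  numCycles counts cycle minima; we rewrite it as a sum of
-- 0/1-indicators over Fin N so that it can be computed pointwise.

indicator : {A : Set} → Dec A → ℕ
indicator (yes _) = 1
indicator (no _)  = 0

indicator-cong : {A B : Set} (a? : Dec A) (b? : Dec B) → (A → B) → (B → A) → indicator a? ≡ indicator b?
indicator-cong (yes a) (yes b) f g = refl
indicator-cong (yes a) (no ¬b) f g = ⊥-elim (¬b (f a))
indicator-cong (no ¬a) (yes b) f g = ⊥-elim (¬a (g b))
indicator-cong (no ¬a) (no ¬b) f g = refl

indicator-no : {A : Set} (a? : Dec A) → ¬ A → indicator a? ≡ 0
indicator-no (yes a) ¬a = ⊥-elim (¬a a)
indicator-no (no _)  ¬a = refl

length-filter-tabulate : ∀ {N} {A : Set} {P : A → Set} (P? : ∀ a → Dec (P a)) (f : Fin N → A) →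
  length (filter P? (tabulate f)) ≡ sum (λ h → indicator (P? (f h)))
length-filter-tabulate {zero}  P? f = refl
length-filter-tabulate {suc N} P? f with P? (f Fin.zero)
... | yes _ = cong suc (length-filter-tabulate P? (f ∘ Fin.suc))
... | no _  = length-filter-tabulate P? (f ∘ Fin.suc)

numCycles-sum : ∀ {N} (p : Fin N → Fin N) → numCycles p ≡ sum (λ h → indicator (isCycleMin? p h))
numCycles-sum p = length-filter-tabulate (isCycleMin? p) id

sum-indicator-≡ : ∀ {N} (u : Fin N) → sum (λ h → indicator (h ≟ u)) ≡ 1
sum-indicator-≡ {suc N} Fin.zero = cong suc (trans
  (sum-cong-≗ {N} (λ h → indicator-no (Fin.suc h ≟ Fin.zero) λ ()))
  (sum-replicate-zero N))
sum-indicator-≡ {suc N} (Fin.suc u) = trans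
  (cong₂ _+_ (indicator-no (Fin.zero ≟ Fin.suc u) λ ())
             (sum-cong-≗ λ h → indicator-cong (Fin.suc h ≟ Fin.suc u) (h ≟ u) Finₚ.suc-injective (cong Fin.suc)))
  (sum-indicator-≡ u)

data Position {N : ℕ} (a₁ a₂ a₃ h : Fin N) : Set where
  at₁   : h ≡ a₁ → Position a₁ a₂ a₃ h
  at₂   : h ≡ a₂ → Position a₁ a₂ a₃ h
  at₃   : h ≡ a₃ → Position a₁ a₂ a₃ h
  other : h ≢ a₁ → h ≢ a₂ → h ≢ a₃ → Position a₁ a₂ a₃ h

position? : ∀ {N} (a₁ a₂ a₃ h : Fin N) → Position a₁ a₂ a₃ h
position? a₁ a₂ a₃ h with h ≟ a₁
... | yes e = at₁ e
... | no h≢a₁ with h ≟ a₂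
...   | yes e = at₂ e
...   | no h≢a₂ with h ≟ a₃
...     | yes e = at₃ e
...     | no h≢a₃ = other h≢a₁ h≢a₂ h≢a₃

module SliceGlue {N : ℕ} (a₁ a₂ a₃ : Fin N) (a₁≢a₂ : a₁ ≢ a₂) (a₂≢a₃ : a₂ ≢ a₃) (a₁≢a₃ : a₁ ≢ a₃) where

  module _ (s : Fin N → Fin N) where
    slice-a₁ : slice s a₁ a₂ a₃ a₁ ≡ s a₃
    slice-a₁ with a₁ ≟ a₁
    ... | yes _ = refl
    ... | no ≢ = ⊥-elim (≢ refl)

    slice-a₂ : slice s a₁ a₂ a₃ a₂ ≡ s a₁
    slice-a₂ with a₂ ≟ a₁
    ... | yes e = ⊥-elim (a₁≢a₂ (sym e))
    ... | no _ with a₂ ≟ a₂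
    ...   | yes _ = refl
    ...   | no ≢ = ⊥-elim (≢ refl)

    slice-a₃ : slice s a₁ a₂ a₃ a₃ ≡ s a₂
    slice-a₃ with a₃ ≟ a₁
    ... | yes e = ⊥-elim (a₁≢a₃ (sym e))
    ... | no _ with a₃ ≟ a₂
    ...   | yes e = ⊥-elim (a₂≢a₃ (sym e))
    ...   | no _ with a₃ ≟ a₃
    ...     | yes _ = refl
    ...     | no ≢ = ⊥-elim (≢ refl)

    slice-other : ∀ h → h ≢ a₁ → h ≢ a₂ → h ≢ a₃ → slice s a₁ a₂ a₃ h ≡ s h
    slice-other h h≢a₁ h≢a₂ h≢a₃ with h ≟ a₁
    ... | yes e = ⊥-elim (h≢a₁ e)
    ... | no _ with h ≟ a₂
    ...   | yes e = ⊥-elim (h≢a₂ e)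
    ...   | no _ with h ≟ a₃
    ...     | yes e = ⊥-elim (h≢a₃ e)
    ...     | no _ = refl

    glue-a₁ : glue s a₁ a₂ a₃ a₁ ≡ s a₂
    glue-a₁ with a₁ ≟ a₁
    ... | yes _ = refl
    ... | no ≢ = ⊥-elim (≢ refl)

    glue-a₂ : glue s a₁ a₂ a₃ a₂ ≡ s a₃
    glue-a₂ with a₂ ≟ a₁
    ... | yes e = ⊥-elim (a₁≢a₂ (sym e))
    ... | no _ with a₂ ≟ a₂
    ...   | yes _ = refl
    ...   | no ≢ = ⊥-elim (≢ refl)

    glue-a₃ : glue s a₁ a₂ a₃ a₃ ≡ s a₁
    glue-a₃ with a₃ ≟ a₁
    ... | yes e = ⊥-elim (a₁≢a₃ (sym e))
    ... | no _ with a₃ ≟ a₂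
    ...   | yes e = ⊥-elim (a₂≢a₃ (sym e))
    ...   | no _ with a₃ ≟ a₃
    ...     | yes _ = refl
    ...     | no ≢ = ⊥-elim (≢ refl)

    glue-other : ∀ h → h ≢ a₁ → h ≢ a₂ → h ≢ a₃ → glue s a₁ a₂ a₃ h ≡ s h
    glue-other h h≢a₁ h≢a₂ h≢a₃ with h ≟ a₁
    ... | yes e = ⊥-elim (h≢a₁ e)
    ... | no _ with h ≟ a₂
    ...   | yes e = ⊥-elim (h≢a₂ e)
    ...   | no _ with h ≟ a₃
    ...     | yes e = ⊥-elim (h≢a₃ e)
    ...     | no _ = refl

  glue∘slice : ∀ (s : Fin N → Fin N) h → glue (slice s a₁ a₂ a₃) a₁ a₂ a₃ h ≡ s h
  glue∘slice s h with position? a₁ a₂ a₃ h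
  ... | at₁ refl = trans (glue-a₁ _) (slice-a₂ s)
  ... | at₂ refl = trans (glue-a₂ _) (slice-a₃ s)
  ... | at₃ refl = trans (glue-a₃ _) (slice-a₁ s)
  ... | other h≢a₁ h≢a₂ h≢a₃ = trans (glue-other _ h h≢a₁ h≢a₂ h≢a₃) (slice-other s h h≢a₁ h≢a₂ h≢a₃)

  slice∘glue : ∀ (s : Fin N → Fin N) h → slice (glue s a₁ a₂ a₃) a₁ a₂ a₃ h ≡ s h
  slice∘glue s h with position? a₁ a₂ a₃ h
  ... | at₁ refl = trans (slice-a₁ _) (glue-a₃ s)
  ... | at₂ refl = trans (slice-a₂ _) (glue-a₁ s)
  ... | at₃ refl = trans (slice-a₃ _) (glue-a₂ s)
  ... | other h≢a₁ h≢a₂ h≢a₃ = trans (slice-other _ h h≢a₁ h≢a₂ h≢a₃) (glue-other s h h≢a₁ h≢a₂ h≢a₃)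

  -- Slicing commutes with post-composition: slicing s and then applying f
  -- is slicing f ∘ s.  (For the face: α ∘ slice σ̄ = slice (α ∘ σ̄).)
  slice-post : ∀ (f s : Fin N → Fin N) h → slice (f ∘ s) a₁ a₂ a₃ h ≡ f (slice s a₁ a₂ a₃ h)
  slice-post f s h with position? a₁ a₂ a₃ h
  ... | at₁ refl = trans (slice-a₁ (f ∘ s)) (cong f (sym (slice-a₁ s)))
  ... | at₂ refl = trans (slice-a₂ (f ∘ s)) (cong f (sym (slice-a₂ s)))
  ... | at₃ refl = trans (slice-a₃ (f ∘ s)) (cong f (sym (slice-a₃ s)))
  ... | other h≢a₁ h≢a₂ h≢a₃ = trans (slice-other (f ∘ s) h h≢a₁ h≢a₂ h≢a₃) (cong f (sym (slice-other s h h≢a₁ h≢a₂ h≢a₃)))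

  slice-id∘glue-id : ∀ h → slice id a₁ a₂ a₃ (glue id a₁ a₂ a₃ h) ≡ h
  slice-id∘glue-id h with position? a₁ a₂ a₃ h
  ... | at₁ refl = trans (cong (slice id a₁ a₂ a₃) (glue-a₁ id)) (slice-a₂ id)
  ... | at₂ refl = trans (cong (slice id a₁ a₂ a₃) (glue-a₂ id)) (slice-a₃ id)
  ... | at₃ refl = trans (cong (slice id a₁ a₂ a₃) (glue-a₃ id)) (slice-a₁ id)
  ... | other h≢a₁ h≢a₂ h≢a₃ = trans (cong (slice id a₁ a₂ a₃) (glue-other id h h≢a₁ h≢a₂ h≢a₃)) (slice-other id h h≢a₁ h≢a₂ h≢a₃)

  glue-id∘slice-id : ∀ h → glue id a₁ a₂ a₃ (slice id a₁ a₂ a₃ h) ≡ h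
  glue-id∘slice-id h = trans (sym (slice-post (glue id a₁ a₂ a₃) id h)) (slice∘glue id h)

  slicePermutation : Permutation′ N → Permutation′ N
  slicePermutation π = permutation (slice (π ⟨$⟩ʳ_) a₁ a₂ a₃) (λ h → glue id a₁ a₂ a₃ (π ⟨$⟩ˡ h))
    (λ h → begin
      slice (π ⟨$⟩ʳ_) a₁ a₂ a₃ (glue id a₁ a₂ a₃ (π ⟨$⟩ˡ h))
        ≡⟨ slice-post (π ⟨$⟩ʳ_) id (glue id a₁ a₂ a₃ (π ⟨$⟩ˡ h)) ⟩
      π ⟨$⟩ʳ slice id a₁ a₂ a₃ (glue id a₁ a₂ a₃ (π ⟨$⟩ˡ h))
        ≡⟨ cong (π ⟨$⟩ʳ_) (slice-id∘glue-id (π ⟨$⟩ˡ h)) ⟩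
      π ⟨$⟩ʳ (π ⟨$⟩ˡ h) ≡⟨ inverseʳ π ⟩
      h ∎)
    (λ h → begin
      glue id a₁ a₂ a₃ (π ⟨$⟩ˡ slice (π ⟨$⟩ʳ_) a₁ a₂ a₃ h)
        ≡⟨ cong (λ w → glue id a₁ a₂ a₃ (π ⟨$⟩ˡ w)) (slice-post (π ⟨$⟩ʳ_) id h) ⟩
      glue id a₁ a₂ a₃ (π ⟨$⟩ˡ (π ⟨$⟩ʳ slice id a₁ a₂ a₃ h))
        ≡⟨ cong (glue id a₁ a₂ a₃) (inverseˡ π) ⟩
      glue id a₁ a₂ a₃ (slice id a₁ a₂ a₃ h) ≡⟨ glue-id∘slice-id h ⟩
      h ∎)
    where open ≡-Reasoning

-- Let C be the π-cycle of x.  If ρ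
-- agrees with π outside C, maps C into itself, and C is the union of three
-- distinct ρ-cycles, through x, y and z, then ρ has two more cycles than π:
-- off C both have the same cycle minima, on C π has one minimum and ρ three.

module CycleCount {N : ℕ} (π ρ : Permutation′ N) (x y z : Fin N) where

  private
    module P = Orbits π
    module R = Orbits ρ
    p q : Fin N → Fin N
    p = π ⟨$⟩ʳ_
    q = ρ ⟨$⟩ʳ_

  InC : Fin N → Set
  InC = SameCycle p x

  minπ minρ : Fin N → Fin N
  minπ w = proj₁ (P.cycleMin w)
  minρ w = proj₁ (R.cycleMin w)

  ρ-min-indicator : ∀ {w h} → SameCycle q w h → indicator (isCycleMin? q h) ≡ indicator (h ≟ minρ w)
  ρ-min-indicator {w} w~h = indicator-cong _ _
    (λ min → R.cycleMin-unique min (proj₂ (proj₂ (R.cycleMin w))) (R.same-trans (R.same-sym w~h) (proj₁ (proj₂ (R.cycleMin w)))))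
    (λ { refl → proj₂ (proj₂ (R.cycleMin w)) })

  ρ-min-absent : ∀ {w h} → ¬ SameCycle q w h → indicator (h ≟ minρ w) ≡ 0
  ρ-min-absent {w} w≁h = indicator-no _ λ { refl → w≁h (proj₁ (proj₂ (R.cycleMin w))) }

  apart : ∀ {u v h} → SameCycle q u h → ¬ SameCycle q u v → ¬ SameCycle q v h
  apart u~h u≁v v~h = u≁v (R.same-trans u~h (R.same-sym v~h))

  module _ (y∈C : InC y) (z∈C : InC z)
           (ρ-outside : ∀ w → ¬ InC w → q w ≡ p w)
           (ρ-inside : ∀ w → InC w → InC (q w))
           (ρ-cover : ∀ h → InC h → SameCycle q x h ⊎ SameCycle q y h ⊎ SameCycle q z h)
           (x≁y : ¬ SameCycle q x y) (x≁z : ¬ SameCycle q x z) (y≁z : ¬ SameCycle q y z) where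

    ρ-cycles-in-C : ∀ {w h} → InC w → SameCycle q w h → InC h
    ρ-cycles-in-C w∈C (k , refl) = walk k
      where
      walk : ∀ k → InC (iter q k _)
      walk zero    = w∈C
      walk (suc k) = ρ-inside _ (walk k)

    threeMins : Fin N → ℕ
    threeMins h = indicator (h ≟ minρ x) + indicator (h ≟ minρ y) + indicator (h ≟ minρ z)

    inside-ρ : ∀ h → InC h → indicator (isCycleMin? q h) ≡ threeMins h
    inside-ρ h h∈C with ρ-cover h h∈C
    ... | inj₁ x~h = begin
      indicator (isCycleMin? q h)      ≡⟨ ρ-min-indicator x~h ⟩
      indicator (h ≟ minρ x)           ≡⟨ sym (trans (+-identityʳ _) (+-identityʳ _)) ⟩
      indicator (h ≟ minρ x) + 0 + 0   ≡⟨ sym (cong₂ _+_ (cong (indicator (h ≟ minρ x) +_) (ρ-min-absent (apart x~h x≁y))) (ρ-min-absent (apart x~h x≁z))) ⟩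
      threeMins h                      ∎
      where open ≡-Reasoning
    ... | inj₂ (inj₁ y~h) = begin
      indicator (isCycleMin? q h)      ≡⟨ ρ-min-indicator y~h ⟩
      indicator (h ≟ minρ y)           ≡⟨ sym (+-identityʳ _) ⟩
      0 + indicator (h ≟ minρ y) + 0   ≡⟨ sym (cong₂ _+_ (cong (_+ indicator (h ≟ minρ y)) (ρ-min-absent (apart y~h (x≁y ∘ R.same-sym)))) (ρ-min-absent (apart y~h y≁z))) ⟩
      threeMins h                      ∎
      where open ≡-Reasoning
    ... | inj₂ (inj₂ z~h) = begin
      indicator (isCycleMin? q h)      ≡⟨ ρ-min-indicator z~h ⟩
      0 + 0 + indicator (h ≟ minρ z)   ≡⟨ sym (cong₂ _+_ (cong₂ _+_ (ρ-min-absent (apart z~h (x≁z ∘ R.same-sym))) (ρ-min-absent (apart z~h (y≁z ∘ R.same-sym)))) refl) ⟩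
      threeMins h                      ∎
      where open ≡-Reasoning

    inside-π : ∀ h → InC h → indicator (h ≟ minπ x) ≡ indicator (isCycleMin? p h)
    inside-π h h∈C = indicator-cong _ _ (λ { refl → proj₂ (proj₂ (P.cycleMin x)) })
      (λ min → P.cycleMin-unique min (proj₂ (proj₂ (P.cycleMin x))) (P.same-trans (P.same-sym h∈C) (proj₁ (proj₂ (P.cycleMin x)))))

    outside-iter : ∀ h → ¬ InC h → ∀ k → iter q k h ≡ iter p k h
    outside-iter h h∉C zero    = refl
    outside-iter h h∉C (suc k) = trans (cong q (outside-iter h h∉C k))
      (ρ-outside _ λ c → h∉C (P.same-trans c (P.same-sym (k , refl))))

    outside-ρ : ∀ h → ¬ InC h → indicator (isCycleMin? q h) ≡ indicator (isCycleMin? p h)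
    outside-ρ h h∉C = indicator-cong _ _
      (λ min k → subst (λ w → toℕ h ≤ toℕ w) (outside-iter h h∉C (toℕ k)) (min k))
      (λ min k → subst (λ w → toℕ h ≤ toℕ w) (sym (outside-iter h h∉C (toℕ k))) (min k))

    not-in-C : ∀ {h m} → ¬ InC h → InC m → indicator (h ≟ m) ≡ 0
    not-in-C h∉C m∈C = indicator-no _ λ { refl → h∉C m∈C }

    minρ-in-C : ∀ w → InC w → InC (minρ w)
    minρ-in-C w w∈C = ρ-cycles-in-C w∈C (proj₁ (proj₂ (R.cycleMin w)))

    outside-three : ∀ h → ¬ InC h → threeMins h ≡ 0
    outside-three h h∉C = cong₂ _+_
      (cong₂ _+_ (not-in-C h∉C (minρ-in-C x (0 , refl))) (not-in-C h∉C (minρ-in-C y y∈C)))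
      (not-in-C h∉C (minρ-in-C z z∈C))

    pointwise : ∀ h → indicator (isCycleMin? q h) + indicator (h ≟ minπ x) ≡ indicator (isCycleMin? p h) + threeMins h
    pointwise h with P.same? x h
    ... | yes h∈C = trans (+-comm (indicator (isCycleMin? q h)) _) (cong₂ _+_ (inside-π h h∈C) (inside-ρ h h∈C))
    ... | no h∉C = begin
      indicator (isCycleMin? q h) + indicator (h ≟ minπ x)
        ≡⟨ cong₂ _+_ (outside-ρ h h∉C) (not-in-C h∉C (proj₁ (proj₂ (P.cycleMin x)))) ⟩
      indicator (isCycleMin? p h) + 0
        ≡⟨ cong (indicator (isCycleMin? p h) +_) (sym (outside-three h h∉C)) ⟩
      indicator (isCycleMin? p h) + threeMins h ∎
      where open ≡-Reasoning

    count : numCycles q + 1 ≡ numCycles p + 3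
    count = begin
      numCycles q + 1                   ≡⟨ cong₂ _+_ (numCycles-sum q) (sym (sum-indicator-≡ (minπ x))) ⟩
      sum isMinρ + sum isMinπx          ≡⟨ sym (∑-distrib-+ {N} isMinρ isMinπx) ⟩
      sum (λ h → isMinρ h + isMinπx h)  ≡⟨ sum-cong-≗ pointwise ⟩
      sum (λ h → isMinπ h + threeMins h) ≡⟨ ∑-distrib-+ {N} isMinπ threeMins ⟩
      sum isMinπ + sum threeMins        ≡⟨ cong₂ _+_ (sym (numCycles-sum p)) sum-threeMins ⟩
      numCycles p + 3                   ∎
      where
      open ≡-Reasoning
      isMinρ isMinπ isMinπx : Fin N → ℕ
      isMinρ h = indicator (isCycleMin? q h)
      isMinπ h = indicator (isCycleMin? p h)
      isMinπx h = indicator (h ≟ minπ x)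
      isMinρ-of : Fin N → Fin N → ℕ
      isMinρ-of w h = indicator (h ≟ minρ w)
      sum-threeMins : sum threeMins ≡ 3
      sum-threeMins = begin
        sum threeMins
          ≡⟨ ∑-distrib-+ {N} (λ h → isMinρ-of x h + isMinρ-of y h) (isMinρ-of z) ⟩
        sum (λ h → isMinρ-of x h + isMinρ-of y h) + sum (isMinρ-of z)
          ≡⟨ cong (_+ sum (isMinρ-of z)) (∑-distrib-+ {N} (isMinρ-of x) (isMinρ-of y)) ⟩
        sum (isMinρ-of x) + sum (isMinρ-of y) + sum (isMinρ-of z)
          ≡⟨ cong₂ _+_ (cong₂ _+_ (sum-indicator-≡ (minρ x)) (sum-indicator-≡ (minρ y))) (sum-indicator-≡ (minρ z)) ⟩
        3 ∎

-- Let x, y = p^i x, z = p^j x lie on a cycle of p of length d,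
-- 0 < i < j < d, and let q agree with p except at x, y, z.  A q-walk that
-- enters the cycle right after position a keeps following p until it meets
-- position 0, i or j again.  This describes the cycles of q through x, y, z
-- for both ways of rerouting them (cutting and rotating, below).

module Detour {N : ℕ} (p q : Fin N → Fin N) (x y z : Fin N) (i j d : ℕ)
  (0<i : 0 < i) (i<j : i < j) (j<d : j < d)
  (y-at : iter p i x ≡ y) (z-at : iter p j x ≡ z) (returns : iter p d x ≡ x)
  (distinct : ∀ {e c} → e < d → c < d → iter p e x ≡ iter p c x → e ≡ c)
  (q-off : ∀ w → w ≢ x → w ≢ y → w ≢ z → q w ≡ p w) where

  Plain : ℕ → Set
  Plain e = 0 < e × e < d × e ≢ i × e ≢ j

  plain-point : ∀ e → Plain e → iter p e x ≢ x × iter p e x ≢ y × iter p e x ≢ z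
  plain-point e (0<e , e<d , e≢i , e≢j) =
      (λ eq → <⇒≢ 0<e (sym (distinct e<d (≤-<-trans z≤n j<d) eq)))
    , (λ eq → e≢i (distinct e<d (<-trans i<j j<d) (trans eq (sym y-at))))
    , (λ eq → e≢j (distinct e<d j<d (trans eq (sym z-at))))

  no-early-return : ∀ e → 0 < e → e < d → iter p e x ≢ x
  no-early-return e 0<e e<d eq = <⇒≢ 0<e (sym (distinct e<d (≤-<-trans z≤n j<d) eq))

  follow : ∀ s a t → q s ≡ iter p (suc a) x → (∀ e → a < e → e ≤ a + t → Plain e)
         → iter q (suc t) s ≡ iter p (suc (a + t)) x
  follow s a zero    qs plain = trans qs (cong (λ m → iter p (suc m) x) (sym (+-identityʳ a)))
  follow s a (suc t) qs plain = begin
    q (iter q (suc t) s)         ≡⟨ cong q (follow s a t qs (λ e a<e e≤ → plain e a<e (≤-trans e≤ (+-monoʳ-≤ a (n≤1+n t))))) ⟩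
    q (iter p (suc (a + t)) x)   ≡⟨ q-off _ x≢ y≢ z≢ ⟩
    iter p (suc (suc (a + t))) x ≡⟨ cong (λ m → iter p (suc m) x) (sym (+-suc a t)) ⟩
    iter p (suc (a + suc t)) x   ∎
    where
    open ≡-Reasoning
    next : ℕ
    next = suc (a + t)
    next-plain : iter p next x ≢ x × iter p next x ≢ y × iter p next x ≢ z
    next-plain = plain-point next (plain next (s≤s (m≤m+n a t)) (subst (next ≤_) (sym (+-suc a t)) ≤-refl))
    x≢ : iter p next x ≢ x
    x≢ = proj₁ next-plain
    y≢ : iter p next x ≢ y
    y≢ = proj₁ (proj₂ next-plain)
    z≢ : iter p next x ≢ z
    z≢ = proj₂ (proj₂ next-plain)

  along : ∀ s a b → q s ≡ iter p (suc a) x → (∀ e → a < e → e < b → Plain e)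
        → ∀ t → suc (a + t) ≤ b → iter q (suc t) s ≡ iter p (suc (a + t)) x
  along s a b qs plain t le = follow s a t qs (λ e a<e e≤ → plain e a<e (<-≤-trans (s≤s e≤) le))

  plain-first : ∀ e → 0 < e → e < i → Plain e
  plain-first e 0<e e<i = 0<e , <-trans e<i (<-trans i<j j<d) , <⇒≢ e<i , <⇒≢ (<-trans e<i i<j)

  plain-second : ∀ e → i < e → e < j → Plain e
  plain-second e i<e e<j = ≤-<-trans z≤n i<e , <-trans e<j j<d , (λ eq → <⇒≢ i<e (sym eq)) , <⇒≢ e<j

  plain-third : ∀ e → j < e → e < d → Plain e
  plain-third e j<e e<d = ≤-<-trans z≤n j<e , e<d , (λ eq → <⇒≢ (<-trans i<j j<e) (sym eq)) , (λ eq → <⇒≢ j<e (sym eq))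

  -- Cutting: q x = p z, q y = p x, q z = p y.  The cycle falls apart into
  -- the q-cycle of y (positions 1 … i), of z (positions i+1 … j) and of x
  -- (positions j+1 … d).
  module Cut (qx : q x ≡ p z) (qy : q y ≡ p x) (qz : q z ≡ p y) (x≢y : x ≢ y) (x≢z : x ≢ z) where

    from-y : ∀ t → suc t ≤ i → iter q (suc t) y ≡ iter p (suc t) x
    from-y = along y 0 i qy plain-first

    from-z : ∀ t → suc (i + t) ≤ j → iter q (suc t) z ≡ iter p (suc (i + t)) x
    from-z = along z i j (trans qz (cong p (sym y-at))) plain-second

    from-x : ∀ t → suc (j + t) ≤ d → iter q (suc t) x ≡ iter p (suc (j + t)) x
    from-x = along x j d (trans qx (cong p (sym z-at))) plain-third

    cover : ∀ k → k < d → SameCycle q x (iter p k x) ⊎ SameCycle q y (iter p k x) ⊎ SameCycle q z (iter p k x)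
    cover zero _ = inj₁ (0 , refl)
    cover (suc k) k<d with suc k ≤? i
    ... | yes k<i = inj₂ (inj₁ (suc k , from-y k k<i))
    ... | no k≮i with suc k ≤? j | above i (suc k) (≰⇒> k≮i)
    ...   | yes k≤j | t , refl = inj₂ (inj₂ (suc t , from-z t k≤j))
    ...   | no k≰j  | _ with above j (suc k) (≰⇒> k≰j)
    ...     | t , refl = inj₁ (suc t , from-x t (<⇒≤ k<d))

    orbit-y : ∀ t → ∃[ e ] (0 < e × e ≤ i × iter q t y ≡ iter p e x)
    orbit-y t with above 0 i 0<i
    ... | i′ , refl with t % suc i′ | m%n<n t (suc i′) | iter-mod q i′ y (trans (from-y i′ ≤-refl) y-at) t
    ...   | zero  | _    | eq = suc i′ , s≤s z≤n , ≤-refl , trans eq (sym y-at)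
    ...   | suc r | r<i′ | eq = suc r , s≤s z≤n , <⇒≤ r<i′ , trans eq (from-y r (<⇒≤ r<i′))

    orbit-x : ∀ t → ∃[ e ] (j < e × e ≤ d × iter q t x ≡ iter p e x)
    orbit-x t with above j d j<d
    ... | t₀ , d≡ with t % suc t₀ | m%n<n t (suc t₀) | iter-mod q t₀ x x-returns t
      where
      x-returns : iter q (suc t₀) x ≡ x
      x-returns = trans (from-x t₀ (≤-reflexive d≡)) (trans (cong (λ m → iter p m x) d≡) returns)
    ...   | zero  | _    | eq = d , j<d , ≤-refl , trans eq (sym returns)
    ...   | suc r | r<t₀ | eq = suc (j + r) , s≤s (m≤m+n j r) , le , trans eq (from-x r le)
      where
      le : suc (j + r) ≤ d
      le = subst (suc (j + r) ≤_) d≡ (s≤s (+-monoʳ-≤ j (<⇒≤ (s≤s⁻¹ r<t₀))))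

    x≁y : ¬ SameCycle q x y
    x≁y (t , eq) with orbit-x t
    ... | e , j<e , e≤d , eq′ with m≤n⇒m<n∨m≡n e≤d
    ...   | inj₂ refl = x≢y (trans (sym returns) (trans (sym eq′) eq))
    ...   | inj₁ e<d  = <⇒≢ (<-trans i<j j<e) (sym (distinct e<d (<-trans i<j j<d) (trans (sym eq′) (trans eq (sym y-at)))))

    x≁z : ¬ SameCycle q x z
    x≁z (t , eq) with orbit-x t
    ... | e , j<e , e≤d , eq′ with m≤n⇒m<n∨m≡n e≤d
    ...   | inj₂ refl = x≢z (trans (sym returns) (trans (sym eq′) eq))
    ...   | inj₁ e<d  = <⇒≢ j<e (sym (distinct e<d j<d (trans (sym eq′) (trans eq (sym z-at)))))

    y≁z : ¬ SameCycle q y z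
    y≁z (t , eq) with orbit-y t
    ... | e , _ , e≤i , eq′ = <⇒≢ (≤-<-trans e≤i i<j)
      (distinct (≤-<-trans e≤i (<-trans i<j j<d)) j<d (trans (sym eq′) (trans eq (sym z-at))))

-- Starting from x, q runs through
-- the arc (i, j) to z, then through (0, i) to y, then through (j, d) back to
-- x: the cycle stays a single cycle, now visiting x, z, y in this order.

module Rotate {N : ℕ} (p q : Fin N → Fin N) (x y z : Fin N) (ti tm th : ℕ) where

  i j d : ℕ
  i = suc ti
  j = suc (i + tm)
  d = suc (j + th)

  module _ (y-at : iter p i x ≡ y) (z-at : iter p j x ≡ z) (returns : iter p d x ≡ x)
    (distinct : ∀ {e c} → e < d → c < d → iter p e x ≡ iter p c x → e ≡ c)
    (q-off : ∀ w → w ≢ x → w ≢ y → w ≢ z → q w ≡ p w)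
    (qx : q x ≡ p y) (qy : q y ≡ p z) (qz : q z ≡ p x) where

    open Detour p q x y z i j d (s≤s z≤n) (s≤s (m≤m+n i tm)) (s≤s (m≤m+n j th)) y-at z-at returns distinct q-off

    from-x : ∀ t → suc (i + t) ≤ j → iter q (suc t) x ≡ iter p (suc (i + t)) x
    from-x = along x i j (trans qx (cong p (sym y-at))) plain-second

    from-z : ∀ t → suc t ≤ i → iter q (suc t) z ≡ iter p (suc t) x
    from-z = along z 0 i qz plain-first

    from-y : ∀ t → suc (j + t) ≤ d → iter q (suc t) y ≡ iter p (suc (j + t)) x
    from-y = along y j d (trans qy (cong p (sym z-at))) plain-third

    x↦z : iter q (suc tm) x ≡ z
    x↦z = trans (from-x tm ≤-refl) z-at

    x↦y : iter q (i + suc tm) x ≡ y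
    x↦y = trans (iter-add q i (suc tm) x) (trans (cong (iter q i) x↦z) (trans (from-z ti ≤-refl) y-at))

    reach : ∀ k → k < d → SameCycle q x (iter p k x)
    reach zero _ = 0 , refl
    reach (suc k) k<d with suc k ≤? i
    ... | yes k<i = suc k + suc tm , trans (iter-add q (suc k) (suc tm) x) (trans (cong (iter q (suc k)) x↦z) (from-z k k<i))
    ... | no k≮i with suc k ≤? j | above i (suc k) (≰⇒> k≮i)
    ...   | yes k≤j | t , refl = suc t , from-x t k≤j
    ...   | no k≰j  | _ with above j (suc k) (≰⇒> k≰j)
    ...     | t , refl = suc t + (i + suc tm) ,
      trans (iter-add q (suc t) (i + suc tm) x) (trans (cong (iter q (suc t)) x↦y) (from-y t (<⇒≤ k<d)))

    reach-all : (∀ w → SameCycle p x w) → ∀ w → SameCycle q x w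
    reach-all p-single w with p-single w
    ... | k , refl with reach (k % d) (m%n<n k d)
    ...   | t , eq = t , trans eq (sym (iter-mod p (j + th) x returns k))

    no-early-return-q : ∀ k → 0 < k → k ≤ i + suc tm → iter q k x ≢ x
    no-early-return-q (suc k) _ k≤ with suc k ≤? suc tm
    ... | yes k≤tm = λ eq → no-early-return (suc (i + k)) (s≤s z≤n) (≤-<-trans le (s≤s (m≤m+n j th)))
                              (trans (sym (from-x k le)) eq)
      where
      le : suc (i + k) ≤ j
      le = s≤s (+-monoʳ-≤ i (s≤s⁻¹ k≤tm))
    ... | no k≰tm with above (suc tm) (suc k) (≰⇒> k≰tm)
    ...   | r , refl = λ eq → no-early-return (suc r) (s≤s z≤n) (≤-<-trans (s≤s r≤ti) (<-trans (s≤s (m≤m+n i tm)) (s≤s (m≤m+n j th))))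
                                (trans (sym x↦r) eq)
      where
      r≤ti : r ≤ ti
      r≤ti = s≤s⁻¹ (+-cancelˡ-≤ (suc tm) (suc r) i (subst₂ _≤_ (sym (+-suc (suc tm) r)) (+-comm i (suc tm)) k≤))
      x↦r : iter q (suc (suc tm + r)) x ≡ iter p (suc r) x
      x↦r = trans (cong (λ m → iter q (suc m) x) (+-comm (suc tm) r))
              (trans (iter-add q (suc r) (suc tm) x) (trans (cong (iter q (suc r)) x↦z) (from-z r (s≤s r≤ti))))

    order : CyclicOrder q x z y
    order = suc tm , i + suc tm , s≤s z≤n , s≤s (m≤n+m (suc tm) ti) , x↦z , x↦y , no-early-return-q

cut-cycle : ∀ {N} (π ρ : Permutation′ N) (x y z : Fin N) → x ≢ y → y ≢ z → x ≢ z
  → CyclicOrder (π ⟨$⟩ʳ_) x y z → (∀ h → ρ ⟨$⟩ʳ h ≡ slice (π ⟨$⟩ʳ_) x y z h)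
  → numCycles (ρ ⟨$⟩ʳ_) ≡ numCycles (π ⟨$⟩ʳ_) + 2
    × ¬ SameCycle (ρ ⟨$⟩ʳ_) x y × ¬ SameCycle (ρ ⟨$⟩ʳ_) y z × ¬ SameCycle (ρ ⟨$⟩ʳ_) x z
cut-cycle π ρ x y z x≢y y≢z x≢z (i , j , 0<i , i<j , y-at , z-at , no-return) ρ-slice =
  two-more , x≁y , y≁z , x≁z
  where
  open Orbits π
  open SliceGlue x y z x≢y y≢z x≢z
  q : Fin _ → Fin _
  q = ρ ⟨$⟩ʳ_
  d : ℕ
  d = proj₁ (minimalPeriod x)
  period-d : MinimalPeriod x d
  period-d = proj₂ (minimalPeriod x)

  j<d : j < d
  j<d with <-cmp j d
  ... | tri< j<d _ _ = j<d
  ... | tri≈ _ j≡d _ = ⊥-elim (no-return d (proj₁ period-d) (≤-reflexive (sym j≡d)) (proj₁ (proj₂ period-d)))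
  ... | tri> _ _ d<j = ⊥-elim (no-return d (proj₁ period-d) (<⇒≤ d<j) (proj₁ (proj₂ period-d)))

  q-off : ∀ w → w ≢ x → w ≢ y → w ≢ z → q w ≡ p w
  q-off w w≢x w≢y w≢z = trans (ρ-slice w) (slice-other p w w≢x w≢y w≢z)

  open Detour p q x y z i j d 0<i i<j j<d y-at z-at (proj₁ (proj₂ period-d)) (position-unique period-d) q-off
  open Cut (trans (ρ-slice x) (slice-a₁ p)) (trans (ρ-slice y) (slice-a₂ p)) (trans (ρ-slice z) (slice-a₃ p)) x≢y x≢z
  open CycleCount π ρ x y z using (InC; count)

  ρ-outside : ∀ w → ¬ InC w → q w ≡ p w
  ρ-outside w w∉C = q-off w (λ { refl → w∉C (0 , refl) }) (λ { refl → w∉C (i , y-at) }) (λ { refl → w∉C (j , z-at) })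

  ρ-inside : ∀ w → InC w → InC (q w)
  ρ-inside w w∈C with position? x y z w
  ... | at₁ refl = suc j , trans (cong p z-at) (sym (trans (ρ-slice x) (slice-a₁ p)))
  ... | at₂ refl = 1 , sym (trans (ρ-slice y) (slice-a₂ p))
  ... | at₃ refl = suc i , trans (cong p y-at) (sym (trans (ρ-slice z) (slice-a₃ p)))
  ... | other w≢x w≢y w≢z = same-trans w∈C (1 , sym (q-off w w≢x w≢y w≢z))

  ρ-cover : ∀ h → InC h → SameCycle q x h ⊎ SameCycle q y h ⊎ SameCycle q z h
  ρ-cover h h∈C with position period-d h∈C
  ... | k , k<d , refl = cover k k<d

  two-more : numCycles q ≡ numCycles p + 2
  two-more = +-cancelʳ-≡ 1 (numCycles q) (numCycles p + 2)
    (trans (count (i , y-at) (j , z-at) ρ-outside ρ-inside ρ-cover x≁y x≁z y≁z) (sym (+-assoc (numCycles p) 2 1)))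

rotate-at : ∀ {N} (p q : Fin N → Fin N) (x y z : Fin N) (i j d : ℕ) → 0 < i → i < j → j < d
  → iter p i x ≡ y → iter p j x ≡ z → iter p d x ≡ x
  → (∀ {e c} → e < d → c < d → iter p e x ≡ iter p c x → e ≡ c)
  → (∀ w → w ≢ x → w ≢ y → w ≢ z → q w ≡ p w) → q x ≡ p y → q y ≡ p z → q z ≡ p x
  → (∀ w → SameCycle p x w)
  → (∀ w → SameCycle q x w) × CyclicOrder q x z y
rotate-at p q x y z i j d 0<i i<j j<d y-at z-at returns distinct q-off qx qy qz p-single
  with above 0 i 0<i
... | ti , refl with above (suc ti) j i<j
...   | tm , refl with above (suc (suc ti + tm)) d j<d
...     | th , refl =
  Rotate.reach-all p q x y z ti tm th y-at z-at returns distinct q-off qx qy qz p-single ,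
  Rotate.order p q x y z ti tm th y-at z-at returns distinct q-off qx qy qz

rotate-cycle : ∀ {N} (π ρ : Permutation′ N) (x y z : Fin N) → x ≢ y → y ≢ z → x ≢ z
  → SingleCycle (π ⟨$⟩ʳ_) → ¬ CyclicOrder (π ⟨$⟩ʳ_) x y z
  → (∀ h → ρ ⟨$⟩ʳ h ≡ slice (π ⟨$⟩ʳ_) x y z h)
  → SingleCycle (ρ ⟨$⟩ʳ_) × CyclicOrder (ρ ⟨$⟩ʳ_) x y z
rotate-cycle π ρ x y z x≢y y≢z x≢z π-single not-ordered ρ-slice =
  (λ u w → R.same-trans (R.same-sym (reaches u)) (reaches w)) , proj₂ rotated
  where
  open Orbits π
  module R = Orbits ρ
  open SliceGlue x y z x≢y y≢z x≢z
  d : ℕ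
  d = proj₁ (minimalPeriod x)
  period-d : MinimalPeriod x d
  period-d = proj₂ (minimalPeriod x)
  y-pos : ∃[ e ] (e < d × iter p e x ≡ y)
  y-pos = position period-d (π-single x y)
  z-pos : ∃[ e ] (e < d × iter p e x ≡ z)
  z-pos = position period-d (π-single x z)
  e₂ e₃ : ℕ
  e₂ = proj₁ y-pos
  e₃ = proj₁ z-pos

  off-x : ∀ {e w} → iter p e x ≡ w → x ≢ w → 0 < e
  off-x {zero}  refl x≢x = ⊥-elim (x≢x refl)
  off-x {suc e} _    _   = s≤s z≤n

  -- intertwining: along the cycle of x, z comes before y
  z-first : e₃ < e₂
  z-first with <-cmp e₃ e₂
  ... | tri< e₃<e₂ _ _ = e₃<e₂
  ... | tri≈ _ e₃≡e₂ _ = ⊥-elim (y≢z (trans (sym (proj₂ (proj₂ y-pos))) (trans (cong (λ m → iter p m x) (sym e₃≡e₂)) (proj₂ (proj₂ z-pos)))))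
  ... | tri> _ _ e₂<e₃ = ⊥-elim (not-ordered (e₂ , e₃ , off-x (proj₂ (proj₂ y-pos)) x≢y , e₂<e₃ , proj₂ (proj₂ y-pos) , proj₂ (proj₂ z-pos)
        , λ k 0<k k≤e₃ → proj₂ (proj₂ period-d) k 0<k (≤-<-trans k≤e₃ (proj₁ (proj₂ z-pos)))))

  rotated : (∀ w → SameCycle (ρ ⟨$⟩ʳ_) x w) × CyclicOrder (ρ ⟨$⟩ʳ_) x y z
  rotated = rotate-at p (ρ ⟨$⟩ʳ_) x z y e₃ e₂ d (off-x (proj₂ (proj₂ z-pos)) x≢z) z-first (proj₁ (proj₂ y-pos))
    (proj₂ (proj₂ z-pos)) (proj₂ (proj₂ y-pos)) (proj₁ (proj₂ period-d)) (position-unique period-d)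
    (λ w w≢x w≢z w≢y → trans (ρ-slice w) (slice-other p w w≢x w≢y w≢z))
    (trans (ρ-slice x) (slice-a₁ p)) (trans (ρ-slice z) (slice-a₃ p)) (trans (ρ-slice y) (slice-a₂ p))
    (π-single x)
  reaches : ∀ w → SameCycle (ρ ⟨$⟩ʳ_) x w
  reaches = proj₁ rotated

genus-drop : ∀ {v v′ n g} → v′ ≡ v + 2 → v + 2 * suc g ≡ n + 1 → v′ + 2 * g ≡ n + 1
genus-drop {v} {v′} {n} {g} v′≡ genus = begin
  v′ + 2 * g       ≡⟨ cong (_+ 2 * g) v′≡ ⟩
  v + 2 + 2 * g    ≡⟨ +-assoc v 2 (2 * g) ⟩
  v + (2 + 2 * g)  ≡⟨ cong (v +_) (sym (*-suc 2 g)) ⟩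
  v + 2 * suc g    ≡⟨ genus ⟩
  n + 1            ∎
  where open ≡-Reasoning

lemma2 : (n g : ℕ) (α σ̄ : Permutation′ (2 * n))
    → IsUnicellularMap n α σ̄ → HasGenus n σ̄ (suc g)
    → (a₁ a₂ a₃ : Fin (2 * n))
    → a₁ ≢ a₂ → a₂ ≢ a₃ → a₁ ≢ a₃
    → CyclicOrder (σ̄ ⟨$⟩ʳ_) a₁ a₂ a₃
    → ¬ CyclicOrder (λ h → α ⟨$⟩ʳ (σ̄ ⟨$⟩ʳ h)) a₁ a₂ a₃
    → ∃[ σ ] ((∀ h → σ ⟨$⟩ʳ h ≡ slice (σ̄ ⟨$⟩ʳ_) a₁ a₂ a₃ h)
        × IsUnicellularMap n α σ × HasGenus n σ g
        × (∀ h → α ⟨$⟩ʳ (σ ⟨$⟩ʳ h) ≡ slice (λ x → α ⟨$⟩ʳ (σ̄ ⟨$⟩ʳ x)) a₁ a₂ a₃ h)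
        × CyclicOrder (λ h → α ⟨$⟩ʳ (σ ⟨$⟩ʳ h)) a₁ a₂ a₃
        × ¬ SameCycle (σ ⟨$⟩ʳ_) a₁ a₂ × ¬ SameCycle (σ ⟨$⟩ʳ_) a₂ a₃
        × ¬ SameCycle (σ ⟨$⟩ʳ_) a₁ a₃
        × (∀ h → glue (σ ⟨$⟩ʳ_) a₁ a₂ a₃ h ≡ σ̄ ⟨$⟩ʳ h)
        × (∀ (s : Fin (2 * n) → Fin (2 * n)) h → glue (slice s a₁ a₂ a₃) a₁ a₂ a₃ h ≡ s h)
        × (∀ (s : Fin (2 * n) → Fin (2 * n)) h → slice (glue s a₁ a₂ a₃) a₁ a₂ a₃ h ≡ s h))
lemma2 n g α σ̄ map genus a₁ a₂ a₃ a₁≢a₂ a₂≢a₃ a₁≢a₃ vertex-ordered face-intertwined =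
  σ , (λ h → refl) , sliced-map , genus-drop (proj₁ vertex) genus , face-sliced , proj₂ face
  , proj₁ (proj₂ vertex) , proj₁ (proj₂ (proj₂ vertex)) , proj₂ (proj₂ (proj₂ vertex))
  , glue∘slice (σ̄ ⟨$⟩ʳ_) , glue∘slice , slice∘glue
  where
  open SliceGlue a₁ a₂ a₃ a₁≢a₂ a₂≢a₃ a₁≢a₃
  open IsUnicellularMap map

  σ : Permutation′ (2 * n)
  σ = slicePermutation σ̄

  vertex : numCycles (σ ⟨$⟩ʳ_) ≡ numCycles (σ̄ ⟨$⟩ʳ_) + 2
         × ¬ SameCycle (σ ⟨$⟩ʳ_) a₁ a₂ × ¬ SameCycle (σ ⟨$⟩ʳ_) a₂ a₃ × ¬ SameCycle (σ ⟨$⟩ʳ_) a₁ a₃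
  vertex = cut-cycle σ̄ σ a₁ a₂ a₃ a₁≢a₂ a₂≢a₃ a₁≢a₃ vertex-ordered (λ h → refl)

  face-sliced : ∀ h → α ⟨$⟩ʳ (σ ⟨$⟩ʳ h) ≡ slice (λ x → α ⟨$⟩ʳ (σ̄ ⟨$⟩ʳ x)) a₁ a₂ a₃ h
  face-sliced h = sym (slice-post (α ⟨$⟩ʳ_) (σ̄ ⟨$⟩ʳ_) h)

  face : SingleCycle (λ h → α ⟨$⟩ʳ (σ ⟨$⟩ʳ h)) × CyclicOrder (λ h → α ⟨$⟩ʳ (σ ⟨$⟩ʳ h)) a₁ a₂ a₃
  face = rotate-cycle (σ̄ ∘ₚ α) (σ ∘ₚ α) a₁ a₂ a₃ a₁≢a₂ a₂≢a₃ a₁≢a₃ oneFace face-intertwined face-sliced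

  sliced-map : IsUnicellularMap n α σ
  sliced-map = record { involution = involution ; fixpointFree = fixpointFree ; oneFace = proj₁ face }
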